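{- If $(x-1)^2\geqslant_\# 0$, i.e., if for every $f\in\#\mathsf P$ the function $w\mapsto (f(w)-1)^2$ belongs to $\#\mathsf P$, then $\mathsf{UP}=\mathsf{coUP}$.
   Context: $\#\mathsf P$ is the class of functions $f:\{0,1\}^*\to\mathbb N$ such that there is a nondeterministic polynomial-time Turing machine whose number of accepting computation paths on every input $w$ equals $f(w)$. For $\varphi,\psi\in\mathbb Q[x_1,\dots,x_k]$, $\varphi\geqslant_\#\psi$ means that for all $f_1,\dots,f_k\in\#\mathsf P$ the function $w\mapsto(\varphi-\psi)(f_1(w),\dots,f_k(w))$ is in $\#\mathsf P$. $\mathsf{UP}$ is the class of languages whose characteristic function lies in $\#\mathsf P$; $\mathsf{coUP}$ is the class of their complements. -}

module Defs where

open import Data.Nat using (ℕ; zero; suc; _+_; _*_; _^_)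
open import Data.Fin using (Fin; zero; suc)
open import Data.Bool using (Bool; true; false; if_then_else_; _∨_; T; not)
open import Data.List using (List; []; _∷_; length; map; concatMap; allFin)
open import Data.Nat.ListAction using (sum)
open import Data.List.Relation.Unary.All using (All)
open import Data.Product using (Σ; _×_; _,_)
open import Data.Unit using (⊤)
open import Data.Integer as ℤ using (ℤ; +_)
open import Relation.Binary.PropositionalEquality using (_≡_)

-- States  : Fin (2 + q);  state 0 = accept, state 1 = reject (both halting).
-- Symbols : Fin (3 + g);  symbol 0 = blank, 1 = bit 0, 2 = bit 1.
-- The transition relation δ is a set of triples (new state, written symbol,
-- head move) for each (state, read symbol).  The tape is infinite to the
-- right; moving left on the leftmost cell keeps the head in place.

data Move : Set where
  left right stay : Move

allMoves : List Move
allMoves = left ∷ right ∷ stay ∷ []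

record NTM : Set where
  field
    q g   : ℕ
    start : Fin (2 + q)
    δ     : Fin (2 + q) → Fin (3 + g) → Fin (2 + q) → Fin (3 + g) → Move → Bool

module Run (M : NTM) where
  open NTM M

  State = Fin (2 + q)
  Sym   = Fin (3 + g)

  blank : Sym
  blank = zero

  encode : Bool → Sym
  encode false = suc zero
  encode true  = suc (suc zero)

  final : State → Bool
  final zero          = true
  final (suc zero)    = true
  final (suc (suc _)) = false

  accepting : State → ℕ
  accepting zero    = 1
  accepting (suc _) = 0

  record Config : Set where
    constructor conf
    field
      st    : State
      lft   : List Sym   -- cells left of the head, nearest first
      hd    : Sym
      rgt   : List Sym   -- cells right of the head (then blanks)
  open Config

  step : State → Sym → Move → Config → Config
  step s a left  (conf _ []      _ r) = conf s [] a r
  step s a left  (conf _ (x ∷ l) _ r) = conf s l x (a ∷ r)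
  step s a right (conf _ l _ [])      = conf s (a ∷ l) blank []
  step s a right (conf _ l _ (x ∷ r)) = conf s (a ∷ l) x r
  step s a stay  (conf _ l _ r)       = conf s l a r

  -- one successor per enabled transition (each is a distinct branch)
  succs : Config → List Config
  succs c =
    concatMap (λ s → concatMap (λ a → concatMap (λ m →
      if δ (st c) (hd c) s a m then step s a m c ∷ [] else [])
      allMoves) (allFin (3 + g))) (allFin (2 + q))

  -- number of accepting computation paths explored within n steps
  -- (a non-final configuration with no successors is a rejecting leaf)
  count : ℕ → Config → ℕ
  count zero    c = if final (st c) then accepting (st c) else 0
  count (suc n) c = if final (st c) then accepting (st c)
                    else sum (map (count n) (succs c))

  HaltsWithin : ℕ → Config → Set
  HaltsWithin zero    c = T (final (st c) ∨ Data.List.null (succs c))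
  HaltsWithin (suc n) c = if final (st c) then ⊤ else All (HaltsWithin n) (succs c)

  initial : List Bool → Config
  initial []      = conf start [] blank []
  initial (b ∷ w) = conf start [] (encode b) (map encode w)

SharpP : (List Bool → ℕ) → Set
SharpP f =
  Σ NTM λ M → Σ ℕ λ c → Σ ℕ λ k → ∀ w →
    let t = c * length w ^ k + c in
    Run.HaltsWithin M t (Run.initial M w) × Run.count M t (Run.initial M w) ≡ f w

Language : Set
Language = List Bool → Bool

χ : Language → List Bool → ℕ
χ L w = if L w then 1 else 0

InUP : Language → Set
InUP L = SharpP (χ L)

InCoUP : Language → Set
InCoUP L = InUP (λ w → not (L w))

XMinusOneSquaredGeq#0 : Set
XMinusOneSquaredGeq#0 =
  ∀ (f : List Bool → ℕ) → SharpP f →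
    Σ (List Bool → ℕ) λ h → SharpP h ×
      (∀ w → + h w ≡ (+ f w ℤ.- + 1) ℤ.* (+ f w ℤ.- + 1))

UP≡coUP : Set
UP≡coUP = ∀ (L : Language) → (InUP L → InCoUP L) × (InCoUP L → InUP L)

{-# OPTIONS --safe #-}
module Submission where

-- On {0,1}-valued functions the polynomial (x - 1)² agrees with 1 - x, so it
-- maps the characteristic function of a language to that of its complement.
-- Hence the hypothesis turns every UP language into a coUP one, and applying
-- this to complements gives the converse inclusion.

open import Defs
open import Data.Nat using (ℕ)
open import Data.Bool using (Bool; true; false; not; if_then_else_)
open import Data.Bool.Properties using (not-involutive)
open import Data.List using (List)
open import Data.Product using (_,_; proj₁; proj₂)
open import Data.Integer as ℤ using (+_)
open import Relation.Binary.PropositionalEquality using (_≡_; cong; trans)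

SharpP-resp : {f g : List Bool → ℕ} → (∀ w → f w ≡ g w) → SharpP f → SharpP g
SharpP-resp f≗g (M , c , k , run) =
  M , c , k , λ w → proj₁ (run w) , trans (proj₂ (run w)) (f≗g w)

indicator-square-minus-one :
  (b : Bool) (h : ℕ) →
  + h ≡ (+ (if b then 1 else 0) ℤ.- + 1) ℤ.* (+ (if b then 1 else 0) ℤ.- + 1) →
  h ≡ (if not b then 1 else 0)
indicator-square-minus-one true  h eq = cong ℤ.∣_∣ eq
indicator-square-minus-one false h eq = cong ℤ.∣_∣ eq

χ-not-not : (L : Language) → ∀ w → χ (λ v → not (not (L v))) w ≡ χ L w
χ-not-not L w = cong (λ b → if b then 1 else 0) (not-involutive (L w))

UP⊆coUP : XMinusOneSquaredGeq#0 → (L : Language) → InUP L → InCoUP L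
UP⊆coUP square L L∈UP with square (χ L) L∈UP
... | h , h∈#P , h≡square =
  SharpP-resp (λ w → indicator-square-minus-one (L w) (h w) (h≡square w)) h∈#P

coUP⊆UP : XMinusOneSquaredGeq#0 → (L : Language) → InCoUP L → InUP L
coUP⊆UP square L L∈coUP =
  SharpP-resp (χ-not-not L) (UP⊆coUP square (λ w → not (L w)) L∈coUP)

corollary2p5 : XMinusOneSquaredGeq#0 → UP≡coUP
corollary2p5 square L = UP⊆coUP square L , coUP⊆UP square L
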